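{- Let $a^\circ_{n,k}(1342)$ be the number of cyclic permutations $\pi\in\mathfrak S_n$ whose one-line notation avoids $\delta_k=k(k-1)\cdots21$ and such that every cyclic rotation of the cycle form $C(\pi)$ avoids $1342$. Then for $n\ge 3$, $a^\circ_{n,3}(1342)=n-1$.
   Context: A permutation $\pi\in\mathfrak S_n$ is cyclic if it is a single $n$-cycle. Its cycle form is $C(\pi)=(1,c_2,\dots,c_n)$ with $c_2=\pi(1)$, $c_{i+1}=\pi(c_i)$. The cyclic rotations of $C(\pi)$ are the sequences $c_i,\dots,c_n,c_1,\dots,c_{i-1}$ (with $c_1=1$). A sequence avoids $\sigma\in\mathfrak S_m$ if no length-$m$ subsequence is order-isomorphic to $\sigma$. One-line notation: $\pi_1\cdots\pi_n$ with $\pi_i=\pi(i)$. -}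

module Defs where

open import Data.Nat using (ℕ; zero; suc; _<_; _∸_)
open import Data.List using (List; []; _∷_; length; lookup; applyUpTo; drop; take; _++_)
open import Data.List.Relation.Binary.Permutation.Propositional using (_↭_)
open import Data.List.Relation.Binary.Sublist.Propositional using (_⊆_)
open import Data.List.Relation.Unary.Unique.Propositional using (Unique)
open import Data.List.Membership.Propositional using (_∈_)
open import Data.Fin using (Fin; cast)
open import Data.Product using (Σ; ∃; _×_)
open import Function.Bundles using (_⇔_)
open import Relation.Binary.PropositionalEquality using (_≡_)
open import Relation.Nullary using (¬_)

IsPerm : ℕ → List ℕ → Set
IsPerm n L = L ↭ applyUpTo suc n

-- π(x) = π_x (1-indexed lookup; default 0 outside the range, never used
-- for genuine permutations).
app : List ℕ → ℕ → ℕ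
app []      _             = 0
app (x ∷ L) zero          = 0
app (x ∷ L) (suc zero)    = x
app (x ∷ L) (suc (suc i)) = app L (suc i)

orbit : List ℕ → ℕ → ℕ → List ℕ
orbit L zero    c = []
orbit L (suc k) c = c ∷ orbit L k (app L c)

cycleForm : ℕ → List ℕ → List ℕ
cycleForm n L = orbit L n 1

IsCyclic : ℕ → List ℕ → Set
IsCyclic n L = Unique (cycleForm n L)

rotate : ℕ → List ℕ → List ℕ
rotate i L = drop i L ++ take i L

OrderIso : List ℕ → List ℕ → Set
OrderIso s t = Σ (length s ≡ length t) λ eq →
  ∀ (i j : Fin (length s)) →
    (lookup s i < lookup s j) ⇔ (lookup t (cast eq i) < lookup t (cast eq j))

Contains : List ℕ → List ℕ → Set
Contains w σ = ∃ λ s → (s ⊆ w) × OrderIso s σ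

Avoids : List ℕ → List ℕ → Set
Avoids w σ = ¬ Contains w σ

δ₃ : List ℕ
δ₃ = 3 ∷ 2 ∷ 1 ∷ []

p1342 : List ℕ
p1342 = 1 ∷ 3 ∷ 4 ∷ 2 ∷ []

Good : ℕ → List ℕ → Set
Good n L = IsPerm n L × IsCyclic n L × Avoids L δ₃ ×
  (∀ i → i < n → Avoids (rotate i (cycleForm n L)) p1342)

HasCount : (List ℕ → Set) → ℕ → Set
HasCount P N = Σ (List (List ℕ)) λ Ls →
  Unique Ls × (∀ L → (L ∈ Ls) ⇔ P L) × length Ls ≡ N

-- Write c t = π^t(1) for the entries of C(π), so that n = c (m+1) for some m. Since C(π)
-- starts with 1, an entry c i before n and an entry c j after it with c j < c i would form
-- the pattern 1 c_i n c_j ≅ 1342; so the entries before n are smaller than those from n on,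
-- and in particular p = π⁻¹(n) = c m is smaller than q = π⁻¹(1) = c (n−1). Avoiding 321 then
-- forces q = p + 1 and makes π increasing on [1, p] and on [q, n], while the cycle order sends
-- [1, p) into [2, p] and (q, n] into [q, n): a strictly increasing map between intervals of equal
-- length is a shift. So π = 2 3 ⋯ p n 1 (p+1) ⋯ (n−1) with 1 ≤ p ≤ n − 1. Conversely each of
-- these n − 1 permutations is cyclic, is a union of two increasing runs, and has the unimodal
-- cycle form 1 2 ⋯ p n (n−1) ⋯ (p+1), in which no cyclic rotation of 1342 can occur.
module Submission where

open import Defs
open import Data.Nat using (ℕ; zero; suc; pred; NonZero; _+_; _∸_; _≤_; _<_; _>_; z≤n; s≤s; z<s; s<s; s≤s⁻¹; s<s⁻¹; _<?_; _≟_; >-nonZero)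
open import Data.Nat.Properties
open import Data.List using (List; []; _∷_; _++_; length; applyUpTo; applyDownFrom; drop; take; map; [_])
open import Data.List.Properties using (take++drop≡id; length-removeAt′; ++-assoc; ++-identityʳ; map-applyUpTo; length-applyUpTo)
open import Data.List.Relation.Binary.Sublist.Propositional using (_⊆_; []; _∷_; _∷ʳ_; minimum; to∈)
open import Data.List.Relation.Binary.Sublist.Propositional.Properties using (++⁺; All-resp-⊆; ∷ˡ⁻; map⁺)
open import Data.List.Relation.Unary.Any using (here; there)
open import Data.List.Relation.Unary.All as All using (All; []; _∷_)
import Data.List.Relation.Unary.All.Properties as All
open import Data.List.Relation.Unary.All.Properties.Core using (¬Any⇒All¬)
open import Data.List.Relation.Unary.AllPairs as AllPairs using (AllPairs; []; _∷_)
import Data.List.Relation.Unary.AllPairs.Properties as AllPairs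
open import Data.List.Relation.Unary.Unique.Propositional using (Unique)
import Data.List.Relation.Unary.Unique.Propositional.Properties as Unique
open import Data.List.Membership.Propositional using (_∈_; _─_)
open import Data.List.Membership.Propositional.Properties using (∈-applyUpTo⁺; ∈-applyUpTo⁻)
open import Data.List.Membership.DecPropositional _≟_ using (_∈?_)
open import Data.List.Relation.Binary.Permutation.Propositional using (_↭_; ↭-sym; ↭-swap; ↭-refl; ↭-prep; ↭⇒↭ₛ; module PermutationReasoning)
open import Data.List.Relation.Binary.Permutation.Propositional.Properties using (shift; ++-comm; ++⁺ˡ; ∈-resp-↭; ↭-length)
open import Data.Fin using () renaming (zero to fz; suc to fs)
open import Data.Product using (∃; ∃₂; _×_; _,_; proj₁; proj₂)
open import Data.Sum using (inj₁; inj₂)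
open import Data.Empty using (⊥; ⊥-elim)
open import Function using (id; _∘_; _∘′_; _⇔_; mk⇔; Equivalence)
open import Relation.Binary.PropositionalEquality using (_≡_; _≢_; refl; sym; trans; cong; cong₂; subst; subst₂; setoid; module ≡-Reasoning)
open import Data.List.Relation.Binary.Permutation.Setoid.Properties (setoid ℕ) using (Unique-resp-↭)
open import Relation.Binary.Definitions using (tri<; tri≈; tri>)
open import Relation.Nullary using (¬_; yes; no)
open import Relation.Nullary.Decidable using (from-yes; from-no)

applyUpTo-cong : ∀ {A : Set} {f g : ℕ → A} n → (∀ {i} → i < n → f i ≡ g i) →
                 applyUpTo f n ≡ applyUpTo g n
applyUpTo-cong zero    f≗g = refl
applyUpTo-cong (suc n) f≗g = cong₂ _∷_ (f≗g z<s) (applyUpTo-cong n (f≗g ∘ s<s))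

applyUpTo-injective : ∀ {A : Set} (f : ℕ → A) n → Unique (applyUpTo f n) →
                      ∀ {i j} → i < n → j < n → f i ≡ f j → i ≡ j
applyUpTo-injective f (suc n) (_ ∷ _) {zero} {zero} _ _ _ = refl
applyUpTo-injective f (suc n) (f0∉ ∷ _) {zero} {suc j} _ j<n eq =
  ⊥-elim (All.applyUpTo⁻ _ n f0∉ (s<s⁻¹ j<n) eq)
applyUpTo-injective f (suc n) (f0∉ ∷ _) {suc i} {zero} i<n _ eq =
  ⊥-elim (All.applyUpTo⁻ _ n f0∉ (s<s⁻¹ i<n) (sym eq))
applyUpTo-injective f (suc n) (_ ∷ u) {suc i} {suc j} i<n j<n eq =
  cong suc (applyUpTo-injective (f ∘ suc) n u (s<s⁻¹ i<n) (s<s⁻¹ j<n) eq)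

∈-applyUpTo-suc⁻ : ∀ {n x} → x ∈ applyUpTo suc n → 1 ≤ x × x ≤ n
∈-applyUpTo-suc⁻ x∈ with ∈-applyUpTo⁻ suc x∈
... | i , i<n , refl = s≤s z≤n , i<n

∈-applyUpTo-suc⁺ : ∀ {n x} → 1 ≤ x → x ≤ n → x ∈ applyUpTo suc n
∈-applyUpTo-suc⁺ (s≤s z≤n) x≤n = ∈-applyUpTo⁺ suc x≤n

∈-tail : ∀ {y z : ℕ} {ys} → y < z → z ∈ y ∷ ys → z ∈ ys
∈-tail y<z (here refl) = ⊥-elim (<-irrefl refl y<z)
∈-tail y<z (there z∈)  = z∈

increasing-⊆ : ∀ {xs ys : List ℕ} → AllPairs _<_ xs → AllPairs _<_ ys → All (_∈ ys) xs → xs ⊆ ys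
increasing-⊆ {[]}     _ _ _ = minimum _
increasing-⊆ {x ∷ xs} {y ∷ ys} (x<xs ∷ xs↑) (_ ∷ ys↑) (here refl ∷ xs∈) =
  refl ∷ increasing-⊆ xs↑ ys↑ (All.zipWith (λ (x<z , z∈) → ∈-tail x<z z∈) (x<xs , xs∈))
increasing-⊆ {x ∷ xs} {y ∷ ys} x∷xs↑@(x<xs ∷ _) (y<ys ∷ ys↑) (there x∈ys ∷ xs∈) =
  y ∷ʳ increasing-⊆ x∷xs↑ ys↑ (x∈ys ∷ All.zipWith (λ (y<z , z∈) → ∈-tail y<z z∈) (All.map (<-trans y<x) x<xs , xs∈))
  where
  y<x = All.lookup y<ys x∈ys

applyUpTo-⊆ : ∀ (f : ℕ → ℕ) n {is} → AllPairs _<_ is → All (_< n) is → map f is ⊆ applyUpTo f n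
applyUpTo-⊆ f n is↑ is<n = subst (_ ⊆_) (map-applyUpTo id f n) (map⁺ f
  (increasing-⊆ is↑ (AllPairs.applyUpTo⁺₁ id n (λ i<j _ → i<j)) (All.map (∈-applyUpTo⁺ id) is<n)))

∈-─ : ∀ {A : Set} {z w : A} ys (z∈ys : z ∈ ys) → w ∈ ys → w ≢ z → w ∈ ys ─ z∈ys
∈-─ (y ∷ ys) (here refl) (here refl) w≢z = ⊥-elim (w≢z refl)
∈-─ (y ∷ ys) (here refl) (there w∈)  _   = w∈
∈-─ (y ∷ ys) (there _)   (here refl) _   = here refl
∈-─ (y ∷ ys) (there z∈)  (there w∈)  w≢z = there (∈-─ ys z∈ w∈ w≢z)

Unique⇒length≤ : ∀ {A : Set} {xs ys : List A} → Unique xs → (∀ {z} → z ∈ xs → z ∈ ys) →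
                 length xs ≤ length ys
Unique⇒length≤ {xs = []}     _            _   = z≤n
Unique⇒length≤ {xs = x ∷ xs} {ys} (x∉xs ∷ xs!) xs⊆ys = begin
  suc (length xs)             ≤⟨ s≤s (Unique⇒length≤ xs! xs⊆ys─x) ⟩
  suc (length (ys ─ x∈ys))    ≡⟨ length-removeAt′ ys _ ⟨
  length ys                   ∎
  where
  open ≤-Reasoning
  x∈ys = xs⊆ys (here refl)
  xs⊆ys─x : ∀ {z} → z ∈ xs → z ∈ ys ─ x∈ys
  xs⊆ys─x z∈xs = ∈-─ ys x∈ys (xs⊆ys (there z∈xs)) (λ z≡x → All.lookup x∉xs z∈xs (sym z≡x))

⊆-++-split : ∀ {A : Set} (xs ys : List A) {s} → s ⊆ xs ++ ys →
             ∃₂ λ s₁ s₂ → s ≡ s₁ ++ s₂ × s₁ ⊆ xs × s₂ ⊆ ys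
⊆-++-split []       ys s⊆ = [] , _ , refl , minimum _ , s⊆
⊆-++-split (x ∷ xs) ys (.x ∷ʳ s⊆) with ⊆-++-split xs ys s⊆
... | s₁ , s₂ , refl , s₁⊆ , s₂⊆ = s₁ , s₂ , refl , x ∷ʳ s₁⊆ , s₂⊆
⊆-++-split (x ∷ xs) ys (refl ∷ s⊆) with ⊆-++-split xs ys s⊆
... | s₁ , s₂ , refl , s₁⊆ , s₂⊆ = x ∷ s₁ , s₂ , refl , refl ∷ s₁⊆ , s₂⊆

rotate-⊆ : ∀ i (w : List ℕ) {s} → s ⊆ rotate i w →
           ∃₂ λ s₁ s₂ → s ≡ s₁ ++ s₂ × s₂ ++ s₁ ⊆ w
rotate-⊆ i w s⊆ with ⊆-++-split (drop i w) (take i w) s⊆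
... | s₁ , s₂ , s≡ , s₁⊆ , s₂⊆ = s₁ , s₂ , s≡ , subst (_ ⊆_) (take++drop≡id i w) (++⁺ s₂⊆ s₁⊆)

AllPairs-resp-⊆ : ∀ {R : ℕ → ℕ → Set} {xs ys} → xs ⊆ ys → AllPairs R ys → AllPairs R xs
AllPairs-resp-⊆ []           _           = []
AllPairs-resp-⊆ (y ∷ʳ xs⊆)   (_ ∷ ys!)   = AllPairs-resp-⊆ xs⊆ ys!
AllPairs-resp-⊆ (refl ∷ xs⊆) (y~ys ∷ ys!) = All-resp-⊆ xs⊆ y~ys ∷ AllPairs-resp-⊆ xs⊆ ys!

AllPairs-⊆-head : ∀ {R : ℕ → ℕ → Set} {x y rest ys} → x ∷ y ∷ rest ⊆ ys → AllPairs R ys → R x y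
AllPairs-⊆-head xy⊆ ys! with AllPairs-resp-⊆ xy⊆ ys!
... | (Rxy ∷ _) ∷ _ = Rxy

range : ℕ → ℕ → List ℕ
range s zero    = []
range s (suc k) = s ∷ range (suc s) k

range≡applyUpTo : ∀ s k → range s k ≡ applyUpTo (s +_) k
range≡applyUpTo s zero    = refl
range≡applyUpTo s (suc k) = cong₂ _∷_ (sym (+-identityʳ s))
  (trans (range≡applyUpTo (suc s) k) (applyUpTo-cong k (λ {i} _ → sym (+-suc s i))))

range-↑ : ∀ s k → AllPairs _<_ (range s k)
range-↑ s k = subst (AllPairs _<_) (sym (range≡applyUpTo s k))
  (AllPairs.applyUpTo⁺₁ (s +_) k (λ i<j _ → +-monoʳ-< s i<j))

range-bounds : ∀ s k → All (λ x → s ≤ x × x < s + k) (range s k)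
range-bounds s k = subst (All _) (sym (range≡applyUpTo s k))
  (All.applyUpTo⁺₁ (s +_) k (λ {i} i<k → m≤m+n s i , +-monoʳ-< s i<k))

range-++ : ∀ s k r → range s (k + r) ≡ range s k ++ range (s + k) r
range-++ s zero    r = cong (λ s′ → range s′ r) (sym (+-identityʳ s))
range-++ s (suc k) r = cong (s ∷_) (trans (range-++ (suc s) k r)
  (cong (λ s′ → range (suc s) k ++ range s′ r) (sym (+-suc s k))))

range-∷ʳ : ∀ s k → range s (suc k) ≡ range s k ++ [ s + k ]
range-∷ʳ s k = trans (cong (range s) (+-comm 1 k)) (range-++ s k 1)

app-applyUpTo : ∀ L → applyUpTo (app L ∘ suc) (length L) ≡ L
app-applyUpTo []      = refl
app-applyUpTo (x ∷ L) = cong (x ∷_) (app-applyUpTo L)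

app-ext : ∀ {n L L′} → length L ≡ n → length L′ ≡ n →
          (∀ i → i < n → app L (suc i) ≡ app L′ (suc i)) → L ≡ L′
app-ext {n} {L} {L′} refl len′ agree = begin
  L                                    ≡⟨ app-applyUpTo L ⟨
  applyUpTo (app L ∘ suc) n            ≡⟨ applyUpTo-cong n (agree _) ⟩
  applyUpTo (app L′ ∘ suc) n           ≡⟨ cong (applyUpTo (app L′ ∘ suc)) len′ ⟨
  applyUpTo (app L′ ∘ suc) (length L′) ≡⟨ app-applyUpTo L′ ⟩
  L′                                   ∎
  where open ≡-Reasoning

app-range-++ : ∀ s k r {i} → i < k → app (range s k ++ r) (suc i) ≡ s + i
app-range-++ s (suc k) r {zero}  _   = sym (+-identityʳ s)
app-range-++ s (suc k) r {suc i} i<k = trans (app-range-++ (suc s) k r (s<s⁻¹ i<k)) (sym (+-suc s i))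

app-range-++-skip : ∀ s k r j → app (range s k ++ r) (suc (k + j)) ≡ app r (suc j)
app-range-++-skip s zero    r j = refl
app-range-++-skip s (suc k) r j = app-range-++-skip (suc s) k r j

iter : (ℕ → ℕ) → ℕ → ℕ → ℕ
iter f zero    x = x
iter f (suc t) x = f (iter f t x)

iter-range : ∀ {n} f → 1 ≤ n → (∀ {x} → 1 ≤ x → x ≤ n → 1 ≤ f x × f x ≤ n) →
             ∀ t → 1 ≤ iter f t 1 × iter f t 1 ≤ n
iter-range f 1≤n f-range zero    = ≤-refl , 1≤n
iter-range f 1≤n f-range (suc t) = let 1≤x , x≤n = iter-range f 1≤n f-range t in f-range 1≤x x≤n

iter-comm : ∀ f t x → iter f t (f x) ≡ f (iter f t x)
iter-comm f zero    x = refl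
iter-comm f (suc t) x = cong f (iter-comm f t x)

orbit-applyUpTo : ∀ L k x → orbit L k x ≡ applyUpTo (λ t → iter (app L) t x) k
orbit-applyUpTo L zero    x = refl
orbit-applyUpTo L (suc k) x = cong (x ∷_) (trans (orbit-applyUpTo L k (app L x))
  (applyUpTo-cong k (λ {t} _ → iter-comm (app L) t x)))

orbit-ascending : ∀ L k r x → (∀ i → i < k → app L (x + i) ≡ suc (x + i)) →
                  orbit L (k + r) x ≡ range x k ++ orbit L r (x + k)
orbit-ascending L zero    r x _    = cong (orbit L r) (sym (+-identityʳ x))
orbit-ascending L (suc k) r x step = cong (x ∷_) (begin
  orbit L (k + r) (app L x)                ≡⟨ cong (orbit L (k + r)) step₀ ⟩
  orbit L (k + r) (suc x)                  ≡⟨ orbit-ascending L k r (suc x) step′ ⟩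
  range (suc x) k ++ orbit L r (suc x + k) ≡⟨ cong (λ y → range (suc x) k ++ orbit L r y) (+-suc x k) ⟨
  range (suc x) k ++ orbit L r (x + suc k) ∎)
  where
  open ≡-Reasoning
  step₀ : app L x ≡ suc x
  step₀ = subst (λ y → app L y ≡ suc y) (+-identityʳ x) (step 0 z<s)
  step′ : ∀ i → i < k → app L (suc x + i) ≡ suc (suc x + i)
  step′ i i<k = subst (λ y → app L y ≡ suc y) (+-suc x i) (step (suc i) (s<s i<k))

orbit-descending : ∀ L d t → (∀ i → i < t → app L (suc (d + i)) ≡ d + i) →
                   orbit L (suc t) (d + t) ≡ applyDownFrom (d +_) (suc t)
orbit-descending L d zero    _    = refl
orbit-descending L d (suc t) step = cong (d + suc t ∷_) (begin
  orbit L (suc t) (app L (d + suc t))  ≡⟨ cong (orbit L (suc t) ∘′ app L) (+-suc d t) ⟩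
  orbit L (suc t) (app L (suc (d + t))) ≡⟨ cong (orbit L (suc t)) (step t ≤-refl) ⟩
  orbit L (suc t) (d + t)              ≡⟨ orbit-descending L d t (λ i i<t → step i (m<n⇒m<1+n i<t)) ⟩
  applyDownFrom (d +_) (suc t)         ∎)
  where open ≡-Reasoning

-- Occurrences of 321 and of the rotations of 1342

private
  both : ∀ {A B : Set} → A → B → A ⇔ B
  both a b = mk⇔ (λ _ → b) (λ _ → a)

  neither : ∀ {A B : Set} → ¬ A → ¬ B → A ⇔ B
  neither ¬a ¬b = mk⇔ (⊥-elim ∘ ¬a) (⊥-elim ∘ ¬b)

  irrefl : ∀ {x y : ℕ} → (x < x) ⇔ (y < y)
  irrefl = neither (<-irrefl refl) (<-irrefl refl)

Contains-δ₃⁺ : ∀ {w a b c} → c < b → b < a → a ∷ b ∷ c ∷ [] ⊆ w → Contains w δ₃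
Contains-δ₃⁺ {a = a} {b} {c} c<b b<a abc⊆w = _ , abc⊆w , refl , iso
  where
  c<a = <-trans c<b b<a
  iso : ∀ i j → _
  iso fz           fz           = irrefl
  iso fz           (fs fz)      = neither (<-asym b<a) (from-no (3 <? 2))
  iso fz           (fs (fs fz)) = neither (<-asym c<a) (from-no (3 <? 1))
  iso (fs fz)      fz           = both b<a (from-yes (2 <? 3))
  iso (fs fz)      (fs fz)      = irrefl
  iso (fs fz)      (fs (fs fz)) = neither (<-asym c<b) (from-no (2 <? 1))
  iso (fs (fs fz)) fz           = both c<a (from-yes (1 <? 3))
  iso (fs (fs fz)) (fs fz)      = both c<b (from-yes (1 <? 2))
  iso (fs (fs fz)) (fs (fs fz)) = irrefl

Contains-δ₃⁻ : ∀ {w} → Contains w δ₃ →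
  ∃ λ a → ∃ λ b → ∃ λ c → a ∷ b ∷ c ∷ [] ⊆ w × c < b × b < a
Contains-δ₃⁻ ((a ∷ b ∷ c ∷ []) , abc⊆w , refl , iso) =
  a , b , c , abc⊆w , Equivalence.from (iso (fs (fs fz)) (fs fz)) (from-yes (1 <? 2))
                    , Equivalence.from (iso (fs fz) fz) (from-yes (2 <? 3))

Contains-1342⁺ : ∀ {w a b c d} → a < d → d < b → b < c → a ∷ b ∷ c ∷ d ∷ [] ⊆ w → Contains w p1342
Contains-1342⁺ {a = a} {b} {c} {d} a<d d<b b<c abcd⊆w = _ , abcd⊆w , refl , iso
  where
  a<b = <-trans a<d d<b
  a<c = <-trans a<b b<c
  d<c = <-trans d<b b<c
  iso : ∀ i j → _
  iso fz                fz                = irrefl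
  iso fz                (fs fz)           = both a<b (from-yes (1 <? 3))
  iso fz                (fs (fs fz))      = both a<c (from-yes (1 <? 4))
  iso fz                (fs (fs (fs fz))) = both a<d (from-yes (1 <? 2))
  iso (fs fz)           fz                = neither (<-asym a<b) (from-no (3 <? 1))
  iso (fs fz)           (fs fz)           = irrefl
  iso (fs fz)           (fs (fs fz))      = both b<c (from-yes (3 <? 4))
  iso (fs fz)           (fs (fs (fs fz))) = neither (<-asym d<b) (from-no (3 <? 2))
  iso (fs (fs fz))      fz                = neither (<-asym a<c) (from-no (4 <? 1))
  iso (fs (fs fz))      (fs fz)           = neither (<-asym b<c) (from-no (4 <? 3))
  iso (fs (fs fz))      (fs (fs fz))      = irrefl
  iso (fs (fs fz))      (fs (fs (fs fz))) = neither (<-asym d<c) (from-no (4 <? 2))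
  iso (fs (fs (fs fz))) fz                = neither (<-asym a<d) (from-no (2 <? 1))
  iso (fs (fs (fs fz))) (fs fz)           = both d<b (from-yes (2 <? 3))
  iso (fs (fs (fs fz))) (fs (fs fz))      = both d<c (from-yes (2 <? 4))
  iso (fs (fs (fs fz))) (fs (fs (fs fz))) = irrefl

Contains-1342⁻ : ∀ {w} → Contains w p1342 →
  ∃ λ a → ∃ λ b → ∃ λ c → ∃ λ d → a ∷ b ∷ c ∷ d ∷ [] ⊆ w × a < d × d < b × b < c
Contains-1342⁻ ((a ∷ b ∷ c ∷ d ∷ []) , abcd⊆w , refl , iso) =
  a , b , c , d , abcd⊆w
  , Equivalence.from (iso fz (fs (fs (fs fz)))) (from-yes (1 <? 2))
  , Equivalence.from (iso (fs (fs (fs fz))) (fs fz)) (from-yes (2 <? 3))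
  , Equivalence.from (iso (fs fz) (fs (fs fz))) (from-yes (3 <? 4))

increasing-runs-avoid-δ₃ : ∀ {U V} → AllPairs _<_ U → AllPairs _<_ V → Avoids (U ++ V) δ₃
increasing-runs-avoid-δ₃ {U} {V} U↑ V↑ contains with Contains-δ₃⁻ contains
... | a , b , c , abc⊆ , c<b , b<a with ⊆-++-split U V abc⊆
... | []              , _ , refl , _   , abc⊆V = <-asym b<a (AllPairs-⊆-head abc⊆V V↑)
... | _ ∷ []          , _ , refl , _   , bc⊆V  = <-asym c<b (AllPairs-⊆-head bc⊆V V↑)
... | _ ∷ _ ∷ []      , _ , refl , ab⊆U , _    = <-asym b<a (AllPairs-⊆-head ab⊆U U↑)
... | _ ∷ _ ∷ _ ∷ []  , _ , refl , abc⊆U , _  = <-asym b<a (AllPairs-⊆-head abc⊆U U↑)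

module Unimodal {X Y : List ℕ} {h : ℕ}
  (X↑ : AllPairs _<_ X) (Y↓ : AllPairs _>_ Y) (X<h : All (_< h) X) (h≤Y : All (h ≤_) Y) where

  ascent-below : ∀ {u v rest} → u ∷ v ∷ rest ⊆ X ++ Y → u < v → u < h
  ascent-below uv⊆ u<v with ⊆-++-split X Y uv⊆
  ... | []        , _ , refl , _   , uv⊆Y = ⊥-elim (<-asym u<v (AllPairs-⊆-head uv⊆Y Y↓))
  ... | _ ∷ []    , _ , refl , u⊆X , _    = All.lookup X<h (to∈ u⊆X)
  ... | _ ∷ _ ∷ _ , _ , refl , u⊆X , _    = All.lookup X<h (to∈ u⊆X)

  descent-above : ∀ {u v rest} → u ∷ v ∷ rest ⊆ X ++ Y → v < u → h ≤ v
  descent-above uv⊆ v<u with ⊆-++-split X Y uv⊆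
  ... | []        , _ , refl , _    , uv⊆Y = All.lookup h≤Y (to∈ (∷ˡ⁻ uv⊆Y))
  ... | _ ∷ []    , _ , refl , _    , v⊆Y  = All.lookup h≤Y (to∈ v⊆Y)
  ... | _ ∷ _ ∷ _ , _ , refl , uv⊆X , _    = ⊥-elim (<-asym v<u (AllPairs-⊆-head uv⊆X X↑))

  unique : Unique (X ++ Y)
  unique = Unique.++⁺ (AllPairs.map <⇒≢ X↑) (AllPairs.map >⇒≢ Y↓)
    (λ (v∈X , v∈Y) → ≤⇒≯ (All.lookup h≤Y v∈Y) (All.lookup X<h v∈X))

  -- Each cyclic rotation 1342, 3421, 4213, 2134 has a descent ending no higher than an ascent starts.
  rotations-avoid-1342 : ∀ i → Avoids (rotate i (X ++ Y)) p1342
  rotations-avoid-1342 i contains with Contains-1342⁻ contains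
  ... | a , b , c , d , abcd⊆ , a<d , d<b , b<c with rotate-⊆ i (X ++ Y) abcd⊆
  ... | s₁ , s₂ , abcd≡ , rotated⊆ = impossible s₁ s₂ abcd≡ rotated⊆
    where
    impossible : ∀ s₁ s₂ → a ∷ b ∷ c ∷ d ∷ [] ≡ s₁ ++ s₂ → s₂ ++ s₁ ⊆ X ++ Y → ⊥
    impossible []                  _ refl w =
      ≤⇒≯ (descent-above (∷ˡ⁻ (∷ˡ⁻ w)) (<-trans d<b b<c)) (<-trans d<b (ascent-below (∷ˡ⁻ w) b<c))
    impossible (_ ∷ [])            _ refl w =
      ≤⇒≯ (descent-above (∷ˡ⁻ (∷ˡ⁻ w)) a<d) (<-trans (<-trans a<d d<b) (ascent-below w b<c))
    impossible (_ ∷ _ ∷ [])        _ refl w =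
      ≤⇒≯ (descent-above (∷ˡ⁻ w) a<d) (ascent-below (∷ˡ⁻ (∷ˡ⁻ w)) (<-trans a<d d<b))
    impossible (_ ∷ _ ∷ _ ∷ [])    _ refl w =
      ≤⇒≯ (descent-above w a<d) (ascent-below (∷ˡ⁻ w) (<-trans a<d d<b))
    impossible (_ ∷ _ ∷ _ ∷ _ ∷ []) [] refl w = impossible [] _ refl w

-- The permutations 2 3 ⋯ (a+1) n 1 (a+2) ⋯ (n−1)

-- f agrees on [1, n] with 2 3 ⋯ (a+1) n 1 (a+2) ⋯ (n−1), where n = 2 + a + b.
record Shape (a b : ℕ) (f : ℕ → ℕ) : Set where
  field
    up     : ∀ i → i < a → f (suc i) ≡ 2 + i
    top    : f (suc a) ≡ 2 + a + b
    bottom : f (2 + a) ≡ 1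
    down   : ∀ i → i < b → f (3 + a + i) ≡ 2 + a + i

candidate : ℕ → ℕ → List ℕ
candidate a b = range 2 a ++ (2 + a + b) ∷ 1 ∷ range (2 + a) b

candidate-Shape : ∀ a b → Shape a b (app (candidate a b))
candidate-Shape a b = record
  { up     = λ i i<a → app-range-++ 2 a _ i<a
  ; top    = trans (cong (app C) (cong suc (sym (+-identityʳ a)))) (app-range-++-skip 2 a _ 0)
  ; bottom = trans (cong (app C) (cong suc (+-comm 1 a))) (app-range-++-skip 2 a _ 1)
  ; down   = λ i i<b → begin
      app C (3 + a + i)                    ≡⟨ cong (app C ∘′ suc) (trans (+-suc a (suc i)) (cong suc (+-suc a i))) ⟨
      app C (suc (a + (2 + i)))            ≡⟨ app-range-++-skip 2 a _ (2 + i) ⟩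
      app (range (2 + a) b) (suc i)        ≡⟨ cong (λ xs → app xs (suc i)) (++-identityʳ (range (2 + a) b)) ⟨
      app (range (2 + a) b ++ []) (suc i)  ≡⟨ app-range-++ (2 + a) b [] i<b ⟩
      2 + a + i                            ∎
  }
  where
  open ≡-Reasoning
  C = candidate a b

Shape-agree : ∀ {a b f g} → Shape a b f → Shape a b g → ∀ i → i < 2 + a + b → f (suc i) ≡ g (suc i)
Shape-agree {a} {b} F G i i<n with <-cmp i a
... | tri< i<a _ _ = trans (Shape.up F i i<a) (sym (Shape.up G i i<a))
... | tri≈ _ refl _ = trans (Shape.top F) (sym (Shape.top G))
... | tri> _ _ a<i with m≤n⇒∃[o]m+o≡n a<i
...   | zero  , refl rewrite +-identityʳ a = trans (Shape.bottom F) (sym (Shape.bottom G))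
...   | suc j , refl rewrite +-suc a j = trans (Shape.down F j j<b) (sym (Shape.down G j j<b))
  where
  j<b : j < b
  j<b = +-cancelˡ-< (2 + a) j b i<n

Shape⇒cycleForm : ∀ {a b} L → Shape a b (app L) →
  cycleForm (2 + a + b) L ≡ range 1 (suc a) ++ applyDownFrom ((2 + a) +_) (suc b)
Shape⇒cycleForm {a} {b} L shape = begin
  orbit L (2 + a + b) 1                                ≡⟨ cong (λ k → orbit L k 1) a+[2+b]≡2+a+b ⟨
  orbit L (a + (2 + b)) 1                              ≡⟨ orbit-ascending L a (2 + b) 1 up ⟩
  range 1 a ++ suc a ∷ orbit L (suc b) (app L (suc a)) ≡⟨ cong (λ x → range 1 a ++ suc a ∷ orbit L (suc b) x) top ⟩
  range 1 a ++ suc a ∷ orbit L (suc b) (2 + a + b)     ≡⟨ cong (λ xs → range 1 a ++ suc a ∷ xs) (orbit-descending L (2 + a) b down) ⟩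
  range 1 a ++ [ suc a ] ++ Y                          ≡⟨ ++-assoc (range 1 a) [ suc a ] Y ⟨
  (range 1 a ++ [ suc a ]) ++ Y                        ≡⟨ cong (_++ Y) (range-∷ʳ 1 a) ⟨
  range 1 (suc a) ++ Y                                 ∎
  where
  open ≡-Reasoning
  open Shape shape
  Y = applyDownFrom ((2 + a) +_) (suc b)
  a+[2+b]≡2+a+b : a + (2 + b) ≡ 2 + a + b
  a+[2+b]≡2+a+b = trans (+-suc a (suc b)) (cong suc (+-suc a b))

module CandidateCycleForm (a b : ℕ) =
  Unimodal {range 1 (suc a)} {applyDownFrom ((2 + a) +_) (suc b)} {2 + a}
  (range-↑ 1 (suc a))
  (AllPairs.applyDownFrom⁺₁ _ (suc b) (λ j<i _ → +-monoʳ-< (2 + a) j<i))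
  (All.map proj₂ (range-bounds 1 (suc a)))
  (All.applyDownFrom⁺₁ _ (suc b) (λ {i} _ → m≤m+n (2 + a) i))

candidate-↭ : ∀ a b → candidate a b ↭ applyUpTo suc (2 + a + b)
candidate-↭ a b = begin
  range 2 a ++ n ∷ 1 ∷ R      ↭⟨ ++⁺ˡ (range 2 a) (↭-swap n 1 ↭-refl) ⟩
  range 2 a ++ 1 ∷ n ∷ R      ↭⟨ shift 1 (range 2 a) (n ∷ R) ⟩
  1 ∷ range 2 a ++ n ∷ R      ↭⟨ ↭-prep 1 (++⁺ˡ (range 2 a) (++-comm [ n ] R)) ⟩
  1 ∷ range 2 a ++ R ++ [ n ] ≡⟨ cong (λ xs → 1 ∷ range 2 a ++ xs) (range-∷ʳ (2 + a) b) ⟨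
  1 ∷ range 2 a ++ range (2 + a) (suc b)
                              ≡⟨ cong (1 ∷_) (range-++ 2 a (suc b)) ⟨
  1 ∷ range 2 (a + suc b)     ≡⟨ cong (λ k → 1 ∷ range 2 k) (+-suc a b) ⟩
  range 1 n                   ≡⟨ range≡applyUpTo 1 n ⟩
  applyUpTo suc n             ∎
  where
  open PermutationReasoning
  n = 2 + a + b
  R = range (2 + a) b

candidate-avoids-δ₃ : ∀ a b → Avoids (candidate a b) δ₃
candidate-avoids-δ₃ a b = subst (λ w → Avoids w δ₃) (++-assoc (range 2 a) [ 2 + a + b ] _)
  (increasing-runs-avoid-δ₃ first-run second-run)
  where
  first-run : AllPairs _<_ (range 2 a ++ [ 2 + a + b ])
  first-run = AllPairs.++⁺ (range-↑ 2 a) ([] ∷ [])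
    (All.map (λ (_ , x<2+a) → <-≤-trans x<2+a (m≤m+n (2 + a) b) ∷ []) (range-bounds 2 a))
  second-run : AllPairs _<_ (1 ∷ range (2 + a) b)
  second-run = All.map (λ (2+a≤x , _) → <-≤-trans (s≤s z<s) 2+a≤x) (range-bounds (2 + a) b)
             ∷ range-↑ (2 + a) b

candidate-Good : ∀ a b → Good (2 + a + b) (candidate a b)
candidate-Good a b = candidate-↭ a b
  , subst Unique (sym cycle≡) unique
  , candidate-avoids-δ₃ a b
  , λ i _ → subst (λ C → Avoids (rotate i C) p1342) (sym cycle≡) (rotations-avoid-1342 i)
  where
  open CandidateCycleForm a b
  cycle≡ = Shape⇒cycleForm (candidate a b) (candidate-Shape a b)

-- Every counted permutation has this shape

increasing-squeeze : ∀ (f : ℕ → ℕ) s t k →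
  (∀ i → suc i < k → f (s + i) < f (s + suc i)) →
  (∀ i → i < k → t ≤ f (s + i) × f (s + i) < t + k) →
  ∀ i → i < k → f (s + i) ≡ t + i
increasing-squeeze f s t k increasing bounded i i<k = ≤-antisym upper (lower i i<k)
  where
  lower : ∀ i → i < k → t + i ≤ f (s + i)
  lower zero    0<k   = subst (_≤ f (s + 0)) (sym (+-identityʳ t)) (proj₁ (bounded 0 0<k))
  lower (suc i) 1+i<k = begin
    t + suc i     ≡⟨ +-suc t i ⟩
    suc (t + i)   ≤⟨ s≤s (lower i (<-trans (n<1+n i) 1+i<k)) ⟩
    suc (f (s + i)) ≤⟨ increasing i 1+i<k ⟩
    f (s + suc i) ∎
    where open ≤-Reasoning
  upper-from : ∀ d i → i + d < k → f (s + i) + d < t + k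
  upper-from zero    i i+0<k = subst (_< t + k) (sym (+-identityʳ _))
    (proj₂ (bounded i (subst (_< k) (+-identityʳ i) i+0<k)))
  upper-from (suc d) i i+d<k = begin-strict
    f (s + i) + suc d   ≡⟨ +-suc (f (s + i)) d ⟩
    suc (f (s + i) + d) ≤⟨ +-monoˡ-≤ d (increasing i (≤-<-trans (m≤m+n (suc i) d) 1+i+d<k)) ⟩
    f (s + suc i) + d   <⟨ upper-from d (suc i) 1+i+d<k ⟩
    t + k               ∎
    where
    open ≤-Reasoning
    1+i+d<k = subst (_< k) (+-suc i d) i+d<k
  upper : f (s + i) ≤ t + i
  upper with d , 1+i+d≡k ← m≤n⇒∃[o]m+o≡n i<k = s≤s⁻¹ (+-cancelʳ-< d (f (s + i)) (suc (t + i)) (begin-strict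
    f (s + i) + d   <⟨ upper-from d i (≤-reflexive 1+i+d≡k) ⟩
    t + k           ≡⟨ cong (t +_) 1+i+d≡k ⟨
    t + (suc i + d) ≡⟨ +-assoc t (suc i) d ⟨
    t + suc i + d   ≡⟨ cong (_+ d) (+-suc t i) ⟩
    suc (t + i) + d ∎))
    where open ≤-Reasoning

≢∧≯⇒< : ∀ {x y : ℕ} → x ≢ y → ¬ y < x → x < y
≢∧≯⇒< x≢y y≮x = ≤∧≢⇒< (≮⇒≥ y≮x) x≢y

module Characterisation
  (n : ℕ) (1<n : 1 < n) (π : ℕ → ℕ)
  (π-range : ∀ {x} → 1 ≤ x → x ≤ n → 1 ≤ π x × π x ≤ n)
  (π-injective : ∀ {x y} → 1 ≤ x → x ≤ n → 1 ≤ y → y ≤ n → π x ≡ π y → x ≡ y)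
  (c-injective : ∀ {i j} → i < n → j < n → iter π i 1 ≡ iter π j 1 → i ≡ j)
  (c-surjective : ∀ {y} → 1 ≤ y → y ≤ n → ∃ λ t → t < n × iter π t 1 ≡ y)
  (π-avoids-321 : ∀ {x y z} → 1 ≤ x → x < y → y < z → z ≤ n → π z < π y → π y < π x → ⊥)
  (c-avoids-1342 : ∀ {i j k l} → i < j → j < k → k < l → l < n →
     iter π i 1 < iter π l 1 → iter π l 1 < iter π j 1 → iter π j 1 < iter π k 1 → ⊥)
  where

  c : ℕ → ℕ
  c t = iter π t 1

  c-range : ∀ t → 1 ≤ c t × c t ≤ n
  c-range = iter-range π (<⇒≤ 1<n) π-range

  c-distinct : ∀ {i j} → i < n → j < n → i ≢ j → c i ≢ c j
  c-distinct i<n j<n i≢j = i≢j ∘ c-injective i<n j<n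

  1<c : ∀ {j} → 0 < j → j < n → 1 < c j
  1<c {j} 0<j j<n = ≤∧≢⇒< (proj₁ (c-range j)) (c-distinct {0} {j} (<-trans 0<j j<n) j<n (<⇒≢ 0<j))

  instance
    n-nonZero : NonZero n
    n-nonZero = >-nonZero (<-trans z<s 1<n)

  ℓ : ℕ
  ℓ = pred n

  ℓ<n : ℓ < n
  ℓ<n = m≤pred[n]⇒suc[m]≤n ≤-refl

  peak : ∃ λ m → suc m < n × c (suc m) ≡ n
  peak with c-surjective (<⇒≤ 1<n) ≤-refl
  ... | zero  , _   , 1≡n  = ⊥-elim (<⇒≢ 1<n 1≡n)
  ... | suc m , m<n , c≡n = m , m<n , c≡n

  m : ℕ
  m = proj₁ peak

  1+m<n : suc m < n
  1+m<n = proj₁ (proj₂ peak)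

  m<ℓ : m < ℓ
  m<ℓ = <⇒≤pred 1+m<n

  -- n = c (suc m) and 1 = c n, so p = π⁻¹(n) and q = π⁻¹(1).
  p q : ℕ
  p = c m
  q = c ℓ

  π[p]≡n : π p ≡ n
  π[p]≡n = proj₂ (proj₂ peak)

  π[q]≡1 : π q ≡ 1
  π[q]≡1 with c-surjective (proj₁ (c-range (suc ℓ))) (proj₂ (c-range (suc ℓ)))
  ... | zero  , _   , 1≡π[q]     = sym 1≡π[q]
  ... | suc t , t<n , π[ct]≡π[q] = ⊥-elim (<-irrefl (trans (cong suc t≡ℓ) (suc-pred n)) t<n)
    where
    t≡ℓ : t ≡ ℓ
    t≡ℓ = c-injective (<-trans (n<1+n t) t<n) ℓ<n
      (π-injective (proj₁ (c-range t)) (proj₂ (c-range t)) (proj₁ (c-range ℓ)) (proj₂ (c-range ℓ)) π[ct]≡π[q])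

  below-peak : ∀ {i} → i ≤ m → c i < c (suc m)
  below-peak {i} i≤m = subst (c i <_) (sym π[p]≡n) (≤∧≢⇒< (proj₂ (c-range i))
    (λ ci≡n → c-distinct (≤-<-trans i≤m (<-trans (n<1+n m) 1+m<n)) 1+m<n (<⇒≢ (s≤s i≤m)) (trans ci≡n (sym π[p]≡n))))

  -- Otherwise 1, c i, n, c j would be a 1342 in C(π).
  c-split : ∀ {i j} → i ≤ m → m < j → j < n → c i < c j
  c-split {zero}  _     m<j j<n = 1<c (≤-<-trans z≤n m<j) j<n
  c-split {suc i} 1+i≤m m<j j<n with m≤n⇒m<n∨m≡n m<j
  ... | inj₂ refl  = below-peak 1+i≤m
  ... | inj₁ 1+m<j = ≢∧≯⇒< (c-distinct (<-trans 1+i<j j<n) j<n (<⇒≢ 1+i<j))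
    (λ cj<ci → c-avoids-1342 z<s (s≤s 1+i≤m) 1+m<j j<n (1<c (<-trans z<s 1+m<j) j<n) cj<ci (below-peak 1+i≤m))
    where
    1+i<j = ≤-<-trans 1+i≤m (<-trans (n<1+n m) 1+m<j)

  p<q : p < q
  p<q = c-split ≤-refl m<ℓ ℓ<n

  1≤p : 1 ≤ p
  1≤p = proj₁ (c-range m)

  q≤n : q ≤ n
  q≤n = proj₂ (c-range ℓ)

  π<n : ∀ {x} → 1 ≤ x → x ≤ n → x ≢ p → π x < n
  π<n 1≤x x≤n x≢p = ≤∧≢⇒< (proj₂ (π-range 1≤x x≤n))
    (λ πx≡n → x≢p (π-injective 1≤x x≤n 1≤p (≤-trans (<⇒≤ p<q) q≤n) (trans πx≡n (sym π[p]≡n))))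

  1<π : ∀ {x} → 1 ≤ x → x ≤ n → x ≢ q → 1 < π x
  1<π 1≤x x≤n x≢q = ≤∧≢⇒< (proj₁ (π-range 1≤x x≤n))
    (λ 1≡πx → x≢q (π-injective 1≤x x≤n (≤-trans 1≤p (<⇒≤ p<q)) q≤n (trans (sym 1≡πx) (sym π[q]≡1))))

  -- An entry strictly between positions p and q would form a 321 with π p = n and π q = 1.
  q≡1+p : q ≡ suc p
  q≡1+p with m≤n⇒m<n∨m≡n p<q
  ... | inj₂ 1+p≡q = sym 1+p≡q
  ... | inj₁ 1+p<q = ⊥-elim (π-avoids-321 1≤p (n<1+n p) 1+p<q q≤n
          (subst (_< π (suc p)) (sym π[q]≡1) (1<π z<s 1+p≤n (<⇒≢ 1+p<q)))
          (subst (π (suc p) <_) (sym π[p]≡n) (π<n z<s 1+p≤n (>⇒≢ (n<1+n p)))))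
    where
    1+p≤n = ≤-trans (<⇒≤ 1+p<q) q≤n

  π-increasing-below-p : ∀ {x y} → 1 ≤ x → x < y → y ≤ p → π x < π y
  π-increasing-below-p 1≤x x<y y≤p = ≢∧≯⇒<
    (λ πx≡πy → <⇒≢ x<y (π-injective 1≤x (<⇒≤ (<-≤-trans x<y y≤n)) 1≤y y≤n πx≡πy))
    (λ πy<πx → π-avoids-321 1≤x x<y y<q q≤n (subst (_< π _) (sym π[q]≡1) (1<π 1≤y y≤n (<⇒≢ y<q))) πy<πx)
    where
    y<q = ≤-<-trans y≤p p<q
    y≤n = ≤-trans (<⇒≤ y<q) q≤n
    1≤y = ≤-trans 1≤x (<⇒≤ x<y)

  π-increasing-above-q : ∀ {x y} → q ≤ x → x < y → y ≤ n → π x < π y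
  π-increasing-above-q q≤x x<y y≤n = ≢∧≯⇒<
    (λ πx≡πy → <⇒≢ x<y (π-injective 1≤x x≤n (≤-trans 1≤x (<⇒≤ x<y)) y≤n πx≡πy))
    (λ πy<πx → π-avoids-321 1≤p p<x x<y y≤n πy<πx (subst (π _ <_) (sym π[p]≡n) (π<n 1≤x x≤n (>⇒≢ p<x))))
    where
    p<x = <-≤-trans p<q q≤x
    x≤n = ≤-trans (<⇒≤ x<y) y≤n
    1≤x = ≤-trans 1≤p (<⇒≤ p<x)

  π-below-p : ∀ {x} → 1 ≤ x → x < p → 1 < π x × π x ≤ p
  π-below-p {x} 1≤x x<p with c-surjective 1≤x (≤-trans (<⇒≤ (<-trans x<p p<q)) q≤n)
  ... | t , t<n , refl = 1<π 1≤x (≤-trans (<⇒≤ (<-trans x<p p<q)) q≤n) (<⇒≢ (<-trans x<p p<q))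
                       , s≤s⁻¹ (subst (c (suc t) <_) q≡1+p (c-split 1+t≤m m<ℓ ℓ<n))
    where
    t≤m : t ≤ m
    t≤m = ≮⇒≥ (λ m<t → <⇒≱ (c-split ≤-refl m<t t<n) (<⇒≤ x<p))
    1+t≤m : suc t ≤ m
    1+t≤m = ≤∧≢⇒< t≤m (λ t≡m → <⇒≢ x<p (cong c t≡m))

  π-above-q : ∀ {x} → q < x → x ≤ n → q ≤ π x × π x < n
  π-above-q {x} q<x x≤n with c-surjective (≤-trans 1≤p (<⇒≤ (<-trans p<q q<x))) x≤n
  ... | t , t<n , refl = subst (_≤ c (suc t)) (sym q≡1+p) (c-split ≤-refl (<-trans m<t (n<1+n t)) 1+t<n)
                       , π<n (≤-trans 1≤p (<⇒≤ (<-trans p<q q<x))) x≤n (>⇒≢ (<-trans p<q q<x))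
    where
    m<t : m < t
    m<t = ≰⇒> (λ t≤m → <⇒≱ (c-split t≤m m<ℓ ℓ<n) (<⇒≤ q<x))
    1+t<n : suc t < n
    1+t<n = ≤∧≢⇒< t<n (λ 1+t≡n → >⇒≢ q<x (cong c (cong pred 1+t≡n)))

  a b : ℕ
  a = pred p
  b = n ∸ (2 + a)

  p≡1+a : p ≡ suc a
  p≡1+a = sym (suc-pred p {{>-nonZero 1≤p}})

  q≡2+a : q ≡ 2 + a
  q≡2+a = trans q≡1+p (cong suc p≡1+a)

  2+a+b≡n : 2 + a + b ≡ n
  2+a+b≡n = m+[n∸m]≡n (subst (_≤ n) q≡2+a q≤n)

  3+a+i≤n : ∀ {i} → i < b → 3 + a + i ≤ n
  3+a+i≤n {i} i<b = subst (3 + a + i ≤_) 2+a+b≡n (+-monoʳ-< (2 + a) i<b)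

  q<3+a+i : ∀ i → q < 3 + a + i
  q<3+a+i i = subst (_< 3 + a + i) (sym q≡2+a) (s≤s (m≤m+n (2 + a) i))

  shape : Shape a b π
  shape = record
    { up     = increasing-squeeze π 1 2 a
        (λ i 1+i<a → π-increasing-below-p z<s (n<1+n (suc i)) (subst (2 + i ≤_) (sym p≡1+a) (≤-trans 1+i<a (n≤1+n a))))
        (λ i i<a → let 1<π , π≤p = π-below-p z<s (subst (suc i <_) (sym p≡1+a) (s<s i<a))
                   in 1<π , s≤s (subst (π (suc i) ≤_) p≡1+a π≤p))
    ; top    = trans (cong π (sym p≡1+a)) (trans π[p]≡n (sym 2+a+b≡n))
    ; bottom = trans (cong π (sym q≡2+a)) π[q]≡1
    ; down   = increasing-squeeze π (3 + a) (2 + a) b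
        (λ i 1+i<b → π-increasing-above-q (<⇒≤ (q<3+a+i i)) (+-monoʳ-< (3 + a) (n<1+n i)) (3+a+i≤n 1+i<b))
        (λ i i<b → let q≤π , π<n = π-above-q (q<3+a+i i) (3+a+i≤n i<b)
                   in subst (_≤ π (3 + a + i)) q≡2+a q≤π , subst (π (3 + a + i) <_) (sym 2+a+b≡n) π<n)
    }

  characterisation : ∃₂ λ a b → 2 + a + b ≡ n × Shape a b π
  characterisation = a , b , 2+a+b≡n , shape

module GoodPermutation (n : ℕ) (1<n : 1 < n) (L : List ℕ) (good : Good n L) where

  L↭ : L ↭ applyUpTo suc n
  L↭ = proj₁ good

  cyclic : IsCyclic n L
  cyclic = proj₁ (proj₂ good)

  avoids-δ₃ : Avoids L δ₃
  avoids-δ₃ = proj₁ (proj₂ (proj₂ good))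

  rotations-avoid-1342 : ∀ i → i < n → Avoids (rotate i (cycleForm n L)) p1342
  rotations-avoid-1342 = proj₂ (proj₂ (proj₂ good))

  π : ℕ → ℕ
  π = app L

  c : ℕ → ℕ
  c t = iter π t 1

  L≡ : applyUpTo (π ∘ suc) n ≡ L
  L≡ = subst (λ k → applyUpTo (π ∘ suc) k ≡ L) (trans (↭-length L↭) (length-applyUpTo suc n)) (app-applyUpTo L)

  cycle≡ : cycleForm n L ≡ applyUpTo c n
  cycle≡ = orbit-applyUpTo L n 1

  π-range : ∀ {x} → 1 ≤ x → x ≤ n → 1 ≤ π x × π x ≤ n
  π-range {suc i} _ i<n = ∈-applyUpTo-suc⁻ (∈-resp-↭ L↭ (subst (π (suc i) ∈_) L≡ (∈-applyUpTo⁺ (π ∘ suc) i<n)))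

  π-injective : ∀ {x y} → 1 ≤ x → x ≤ n → 1 ≤ y → y ≤ n → π x ≡ π y → x ≡ y
  π-injective {suc i} {suc j} _ i<n _ j<n = cong suc ∘ applyUpTo-injective (π ∘ suc) n L-unique i<n j<n
    where
    L-unique = subst Unique (sym L≡)
      (Unique-resp-↭ (↭⇒↭ₛ (↭-sym L↭)) (Unique.applyUpTo⁺₁ suc n (λ i<j _ → <⇒≢ (s<s i<j))))

  c-unique : Unique (applyUpTo c n)
  c-unique = subst Unique cycle≡ cyclic

  c-injective : ∀ {i j} → i < n → j < n → c i ≡ c j → i ≡ j
  c-injective = applyUpTo-injective c n c-unique

  c-surjective : ∀ {y} → 1 ≤ y → y ≤ n → ∃ λ t → t < n × c t ≡ y
  c-surjective {y} 1≤y y≤n with y ∈? applyUpTo c n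
  ... | yes y∈ = let t , t<n , y≡ct = ∈-applyUpTo⁻ c y∈ in t , t<n , sym y≡ct
  ... | no  y∉ = ⊥-elim (<-irrefl refl
          (subst₂ _≤_ (cong suc (length-applyUpTo c n)) (length-applyUpTo suc n)
            (Unique⇒length≤ (¬Any⇒All¬ _ y∉ ∷ c-unique) in-range)))
    where
    in-range : ∀ {z} → z ∈ y ∷ applyUpTo c n → z ∈ applyUpTo suc n
    in-range (here refl) = ∈-applyUpTo-suc⁺ 1≤y y≤n
    in-range (there z∈) with ∈-applyUpTo⁻ c z∈
    ... | t , _ , refl = let 1≤ct , ct≤n = iter-range π (<⇒≤ 1<n) π-range t in ∈-applyUpTo-suc⁺ 1≤ct ct≤n

  π-avoids-321 : ∀ {x y z} → 1 ≤ x → x < y → y < z → z ≤ n → π z < π y → π y < π x → ⊥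
  π-avoids-321 {suc x} {suc y} {suc z} _ (s<s x<y) (s<s y<z) z<n πz<πy πy<πx =
    avoids-δ₃ (Contains-δ₃⁺ πz<πy πy<πx (subst (map (π ∘ suc) (x ∷ y ∷ z ∷ []) ⊆_) L≡
      (applyUpTo-⊆ (π ∘ suc) n ((x<y ∷ <-trans x<y y<z ∷ []) ∷ (y<z ∷ []) ∷ [] ∷ [])
        (<-trans x<y (<-trans y<z z<n) ∷ <-trans y<z z<n ∷ z<n ∷ []))))

  -- Only the trivial rotation of C(π) is needed in this direction.
  c-avoids-1342 : ∀ {i j k l} → i < j → j < k → k < l → l < n → c i < c l → c l < c j → c j < c k → ⊥
  c-avoids-1342 {i} {j} {k} {l} i<j j<k k<l l<n ci<cl cl<cj cj<ck =
    rotations-avoid-1342 0 (<-trans z<s 1<n) (Contains-1342⁺ ci<cl cl<cj cj<ck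
      (subst (map c (i ∷ j ∷ k ∷ l ∷ []) ⊆_) (trans (sym cycle≡) (sym (++-identityʳ _)))
        (applyUpTo-⊆ c n ((i<j ∷ i<k ∷ i<l ∷ []) ∷ (j<k ∷ j<l ∷ []) ∷ (k<l ∷ []) ∷ [] ∷ [])
          (<-trans i<j j<n ∷ j<n ∷ <-trans k<l l<n ∷ l<n ∷ []))))
    where
    j<l = <-trans j<k k<l
    i<k = <-trans i<j j<k
    i<l = <-trans i<j j<l
    j<n = <-trans j<l l<n

  open Characterisation n 1<n π π-range π-injective c-injective c-surjective π-avoids-321 c-avoids-1342
    public using (characterisation)

candidates : ℕ → List (List ℕ)
candidates n = applyUpTo (λ a → candidate a (n ∸ (2 + a))) (n ∸ 1)

<∸1⇒2+≤ : ∀ {n a} → a < n ∸ 1 → 2 + a ≤ n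
<∸1⇒2+≤ {suc n} a<n = s≤s a<n

candidate-injective : ∀ {a b a′ b′} → a < a′ → 2 + a′ ≤ 2 + a + b → candidate a b ≢ candidate a′ b′
candidate-injective {a} {b} {a′} {b′} a<a′ 2+a′≤n eq =
  <⇒≱ (<-≤-trans (+-monoʳ-< 2 a<a′) 2+a′≤n) (≤-reflexive (begin
    2 + a + b                     ≡⟨ Shape.top (candidate-Shape a b) ⟨
    app (candidate a b) (suc a)   ≡⟨ cong (λ L → app L (suc a)) eq ⟩
    app (candidate a′ b′) (suc a) ≡⟨ Shape.up (candidate-Shape a′ b′) a a<a′ ⟩
    2 + a                         ∎))
  where open ≡-Reasoning

candidates-unique : ∀ n → Unique (candidates n)
candidates-unique n = Unique.applyUpTo⁺₁ _ (n ∸ 1) λ {i} {j} i<j j<n∸1 →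
  candidate-injective i<j
    (subst (2 + j ≤_) (sym (m+[n∸m]≡n (<∸1⇒2+≤ {n} (<-trans i<j j<n∸1)))) (<∸1⇒2+≤ j<n∸1))

∈-candidates⇒Good : ∀ n {L} → L ∈ candidates n → Good n L
∈-candidates⇒Good n L∈ with ∈-applyUpTo⁻ _ L∈
... | a , a<n∸1 , refl =
  subst (λ k → Good k (candidate a (n ∸ (2 + a)))) (m+[n∸m]≡n (<∸1⇒2+≤ a<n∸1)) (candidate-Good a (n ∸ (2 + a)))

Good⇒∈-candidates : ∀ n {L} → 1 < n → Good n L → L ∈ candidates n
Good⇒∈-candidates n {L} 1<n good with GoodPermutation.characterisation n 1<n L good
... | a , b , refl , shape =
  subst (_∈ candidates n) (sym L≡candidate) (subst (λ b′ → candidate a b′ ∈ candidates n) (m+n∸m≡n (2 + a) b) listed)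
  where
  listed : candidate a (n ∸ (2 + a)) ∈ candidates n
  listed = ∈-applyUpTo⁺ (λ a′ → candidate a′ (n ∸ (2 + a′))) (s≤s (m≤m+n a b))
  L≡candidate : L ≡ candidate a b
  L≡candidate = app-ext (trans (↭-length (proj₁ good)) (length-applyUpTo suc n))
    (trans (↭-length (candidate-↭ a b)) (length-applyUpTo suc n))
    (Shape-agree shape (candidate-Shape a b))

lemma3p4 : ∀ (n : ℕ) → 3 ≤ n → HasCount (Good n) (n ∸ 1)
lemma3p4 n 3≤n = candidates n
  , candidates-unique n
  , (λ L → mk⇔ (∈-candidates⇒Good n) (Good⇒∈-candidates n (≤-trans (n≤1+n 2) 3≤n)))
  , length-applyUpTo _ (n ∸ 1)
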